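{- Let $r \geqslant 1$ and $k \geqslant 1$ be integers, and let $t \geqslant 2$ and $1 \leqslant n_1 \leqslant \cdots \leqslant n_t$ be integers. The complete $t$-partite graph $K_{n_1,n_2,\ldots,n_t}$ has an $r$-equitable $k$-coloring in which at least one color is missing if and only if $k \geqslant \left(\sum_{i=1}^t \lceil n_i/r \rceil\right) + 1$.
   Context: All graphs are finite, simple and undirected. For a positive integer $k$, a (proper) $k$-coloring of a graph $G=(V,E)$ is a map $f: V \to \{1,\ldots,k\}$ with $f(u)\neq f(v)$ whenever $uv \in E$; the color classes are the sets $\{u \in V : f(u)=c\}$ for $c=1,\ldots,k$, and these may be empty. A color is missing if its color class is empty. For an integer $r \geqslant 0$, a $k$-coloring is $r$-equitable if the sizes of any two of its $k$ color classes (including empty ones) differ by at most $r$. $K_{n_1,\ldots,n_t}$ denotes the complete $t$-partite graph whose vertex set is partitioned into independent sets $V_1,\ldots,V_t$ with $|V_i|=n_i$, every vertex of $V_i$ adjacent to every vertex of $V_j$ for $i \neq j$. -}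

module Defs where

open import Data.Nat using (ℕ; zero; suc; _+_; _∸_; _≤_; NonZero)
open import Data.Nat.DivMod using (_/_)
open import Data.Fin using (Fin; _≟_)
open import Data.Product using (Σ; _,_; proj₁; ∃)
open import Data.List using (List; map; concatMap; allFin; filter; length)
open import Data.Nat.ListAction using (sum)
open import Relation.Binary.PropositionalEquality using (_≡_; _≢_)

Vertex : (t : ℕ) → (Fin t → ℕ) → Set
Vertex t n = Σ (Fin t) (λ i → Fin (n i))

Adj : (t : ℕ) (n : Fin t → ℕ) → Vertex t n → Vertex t n → Set
Adj t n u v = proj₁ u ≢ proj₁ v

allVertices : (t : ℕ) (n : Fin t → ℕ) → List (Vertex t n)
allVertices t n = concatMap (λ i → map (λ x → (i , x)) (allFin (n i))) (allFin t)

Proper : (t : ℕ) (n : Fin t → ℕ) (k : ℕ) → (Vertex t n → Fin k) → Set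
Proper t n k f = ∀ u v → Adj t n u v → f u ≢ f v

classSize : (t : ℕ) (n : Fin t → ℕ) (k : ℕ) → (Vertex t n → Fin k) → Fin k → ℕ
classSize t n k f c = length (filter (λ v → f v ≟ c) (allVertices t n))

-- r-equitable: any two color classes (including empty ones) differ in size by at most r.
REquitable : (t : ℕ) (n : Fin t → ℕ) (k r : ℕ) → (Vertex t n → Fin k) → Set
REquitable t n k r f = ∀ c d → classSize t n k f c ≤ classSize t n k f d + r

SomeColorMissing : (t : ℕ) (n : Fin t → ℕ) (k : ℕ) → (Vertex t n → Fin k) → Set
SomeColorMissing t n k f = ∃ λ c → ∀ v → f v ≢ c

⌈_/_⌉ : ℕ → (r : ℕ) → .{{NonZero r}} → ℕ
⌈ m / r ⌉ = (m + r ∸ 1) / r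

sumCeil : (t : ℕ) → (Fin t → ℕ) → (r : ℕ) → .{{NonZero r}} → ℕ
sumCeil t n r = sum (map (λ i → ⌈ n i / r ⌉) (allFin t))

-- In a proper colouring of a complete multipartite graph every colour class lies inside one
-- part. If some colour class is empty, r-equitability bounds every class by r, so part i
-- needs at least ⌈ n_i / r ⌉ colours of its own and, counting the missing colour,
-- k ≥ ∑ ⌈ n_i / r ⌉ + 1. Conversely, give part i its own block of ⌈ n_i / r ⌉ consecutive
-- colours, used in runs of r vertices: all classes then have at most r vertices and the
-- colour ∑ ⌈ n_i / r ⌉ is unused.
module Submission where

open import Defs
open import Level using (Level)
open import Data.Fin using (Fin; zero; suc; toℕ; fromℕ<; _≟_; punchIn) renaming (_≤_ to _≤ᶠ_)
open import Data.Fin.Properties using (toℕ<n; toℕ-fromℕ<; punchInᵢ≢i; any?)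
open import Data.List using (List; []; _∷_; _++_; map; concatMap; allFin; tabulate; filter; length)
open import Data.List.Properties using (map-++; map-∘; map-tabulate)
import Data.Nat.ListAction as List
open import Data.Nat.ListAction.Properties using (sum-++)
open import Data.Nat using (ℕ; zero; suc; _+_; _*_; _∸_; _≤_; _<_; z≤n; s≤s; NonZero)
open import Data.Nat.DivMod using (_/_; _%_; m/n*n≤m; m*n/n≡m; /-monoˡ-≤; m<n*o⇒m/o<n; m≡m%n+[m/n]*n; m%n<n)
open import Data.Nat.Properties hiding (_≟_)
import Data.Nat.Properties as ℕ using (_≟_)
open import Data.Product using (Σ; _,_; proj₂; ∃; _×_)
open import Function using (_∘_; id)
open import Function.Bundles using (_⇔_; mk⇔)
open import Relation.Binary.PropositionalEquality
open import Relation.Nullary using (Dec; yes; no; ¬_; contradiction)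
open import Algebra.Properties.Semiring.Sum +-*-semiring
  using (sum; sum-syntax; sum-remove; sum-cong-≗; sum-replicate-zero; ∑-comm; *-distribˡ-sum)

private
  variable
    a : Level
    A B : Set a

indicator : Dec A → ℕ
indicator (yes _) = 1
indicator (no _)  = 0

indicator-yes : (A? : Dec A) → A → indicator A? ≡ 1
indicator-yes (yes _) _ = refl
indicator-yes (no ¬a) a = contradiction a ¬a

indicator-no : (A? : Dec A) → ¬ A → indicator A? ≡ 0
indicator-no (yes a) ¬a = contradiction a ¬a
indicator-no (no _)  _  = refl

indicator>0⇒ : (A? : Dec A) → 0 < indicator A? → A
indicator>0⇒ (yes a) _ = a

indicator≤1 : (A? : Dec A) → indicator A? ≤ 1
indicator≤1 (yes _) = ≤-refl
indicator≤1 (no _)  = z≤n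

indicator-mono : (A? : Dec A) (B? : Dec B) → (A → B) → indicator A? ≤ indicator B?
indicator-mono (yes a) B? A→B = ≤-reflexive (sym (indicator-yes B? (A→B a)))
indicator-mono (no _)  B? A→B = z≤n

≤*indicator>0 : ∀ {m n} → m ≤ n → m ≤ n * indicator (0 <? m)
≤*indicator>0 {m} {n} m≤n with 0 <? m
... | yes _   = subst (m ≤_) (sym (*-identityʳ n)) m≤n
... | no m≯0 = ≤-trans (≮⇒≥ m≯0) z≤n

∑-mono-≤ : ∀ {m} {f g : Fin m → ℕ} → (∀ i → f i ≤ g i) → sum f ≤ sum g
∑-mono-≤ {zero}  _   = z≤n
∑-mono-≤ {suc m} f≤g = +-mono-≤ (f≤g zero) (∑-mono-≤ (f≤g ∘ suc))

∑-const : ∀ m c → ∑[ i < m ] c ≡ m * c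
∑-const zero    c = refl
∑-const (suc m) c = cong (c +_) (∑-const m c)

∑≡0 : ∀ {m} {f : Fin m → ℕ} → (∀ i → f i ≡ 0) → sum f ≡ 0
∑≡0 {m} f≡0 = trans (sum-cong-≗ f≡0) (sum-replicate-zero m)

f≤∑f : ∀ {m} (f : Fin m → ℕ) i → f i ≤ sum f
f≤∑f {suc m} f i = ≤-trans (m≤m+n (f i) _) (≤-reflexive (sym (sum-remove f)))

∑>0⇒∃>0 : ∀ {m} (f : Fin m → ℕ) → 0 < sum f → ∃ λ i → 0 < f i
∑>0⇒∃>0 f ∑f>0 with any? (λ i → 0 <? f i)
... | yes witness = witness
... | no  none    = contradiction (∑≡0 (λ i → n≤0⇒n≡0 (≮⇒≥ (λ fi>0 → none (i , fi>0))))) (>⇒≢ ∑f>0)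

∑-concentrated : ∀ {m} (f : Fin m → ℕ) i → (∀ j → j ≢ i → f j ≡ 0) → sum f ≡ f i
∑-concentrated {suc m} f i vanish = begin
  sum f                                  ≡⟨ sum-remove f ⟩
  f i + ∑[ j < m ] f (punchIn i j)       ≡⟨ cong (f i +_) (∑≡0 (λ j → vanish _ (punchInᵢ≢i i j))) ⟩
  f i + 0                                ≡⟨ +-identityʳ (f i) ⟩
  f i                                    ∎
  where open ≡-Reasoning

∑≤-singleSupport : ∀ {m b} (f : Fin m → ℕ) → (∀ i → f i ≤ b) →
  (∀ i j → 0 < f i → 0 < f j → i ≡ j) → sum f ≤ b
∑≤-singleSupport f f≤b unique with 0 <? sum f
... | no  ∑f≯0 = ≤-trans (≮⇒≥ ∑f≯0) z≤n
... | yes ∑f>0 with ∑>0⇒∃>0 f ∑f>0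
...   | i , fi>0 = subst (_≤ _) (sym (∑-concentrated f i vanish)) (f≤b i)
  where
  vanish : ∀ j → j ≢ i → f j ≡ 0
  vanish j j≢i = n≤0⇒n≡0 (≮⇒≥ (λ fj>0 → j≢i (unique j i fj>0 fi>0)))

∑-indicator-≟ : ∀ {k} (a : Fin k) → ∑[ c < k ] indicator (a ≟ c) ≡ 1
∑-indicator-≟ a = trans (∑-concentrated _ a (λ c c≢a → indicator-no (a ≟ c) (c≢a ∘ sym)))
                        (indicator-yes (a ≟ a) refl)

≤1-with-zero⇒∑<m : ∀ {m} (f : Fin m → ℕ) i → (∀ j → f j ≤ 1) → f i ≡ 0 → sum f < m
≤1-with-zero⇒∑<m {suc m} f i f≤1 fi≡0 = s≤s (begin
  sum f                                  ≡⟨ sum-remove f ⟩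
  f i + ∑[ j < m ] f (punchIn i j)       ≡⟨ cong (_+ ∑[ j < m ] f (punchIn i j)) fi≡0 ⟩
  ∑[ j < m ] f (punchIn i j)             ≤⟨ ∑-mono-≤ (f≤1 ∘ punchIn i) ⟩
  ∑[ j < m ] 1                           ≡⟨ ∑-const m 1 ⟩
  m * 1                                  ≡⟨ *-identityʳ m ⟩
  m                                      ∎)
  where open ≤-Reasoning

length-filter≡∑indicator : ∀ {p} {P : A → Set p} (P? : ∀ x → Dec (P x)) (xs : List A) →
  length (filter P? xs) ≡ List.sum (map (indicator ∘ P?) xs)
length-filter≡∑indicator P? []       = refl
length-filter≡∑indicator P? (x ∷ xs) with P? x
... | yes _ = cong suc (length-filter≡∑indicator P? xs)
... | no  _ = length-filter≡∑indicator P? xs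

sum-map-concatMap : (h : B → ℕ) (G : A → List B) (xs : List A) →
  List.sum (map h (concatMap G xs)) ≡ List.sum (map (List.sum ∘ map h ∘ G) xs)
sum-map-concatMap h G []       = refl
sum-map-concatMap h G (x ∷ xs) = begin
  List.sum (map h (G x ++ concatMap G xs))                 ≡⟨ cong List.sum (map-++ h (G x) _) ⟩
  List.sum (map h (G x) ++ map h (concatMap G xs))         ≡⟨ sum-++ (map h (G x)) _ ⟩
  List.sum (map h (G x)) + List.sum (map h (concatMap G xs))
    ≡⟨ cong (_ +_) (sum-map-concatMap h G xs) ⟩
  List.sum (map h (G x)) + List.sum (map (List.sum ∘ map h ∘ G) xs) ∎
  where open ≡-Reasoning

sum-map-allFin : ∀ m (f : Fin m → ℕ) → List.sum (map f (allFin m)) ≡ sum f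
sum-map-allFin m f = trans (cong List.sum (map-tabulate id f)) (sum-tabulate m f)
  where
  sum-tabulate : ∀ m (f : Fin m → ℕ) → List.sum (tabulate f) ≡ sum f
  sum-tabulate zero    f = refl
  sum-tabulate (suc m) f = cong (f zero +_) (sum-tabulate m (f ∘ suc))

⌈/⌉-suc : ∀ m r → ⌈ m / suc r ⌉ ≡ (m + r) / suc r
⌈/⌉-suc m r = cong (λ a → (a ∸ 1) / suc r) (+-suc m r)

⌈/⌉-least : ∀ {m q} r .{{_ : NonZero r}} → m ≤ r * q → ⌈ m / r ⌉ ≤ q
⌈/⌉-least {m} {q} (suc r) m≤r*q rewrite ⌈/⌉-suc m r = <⇒≤pred (m<n*o⇒m/o<n (begin-strict
  m + r                  ≤⟨ +-monoˡ-≤ r m≤r*q ⟩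
  suc r * q + r          <⟨ +-monoʳ-< (suc r * q) (n<1+n r) ⟩
  suc r * q + suc r      ≡⟨ +-comm (suc r * q) (suc r) ⟩
  suc r + suc r * q      ≡⟨ cong (suc r +_) (*-comm (suc r) q) ⟩
  suc q * suc r          ∎))
  where open ≤-Reasoning

/<⌈/⌉ : ∀ {x m} r .{{_ : NonZero r}} → x < m → x / r < ⌈ m / r ⌉
/<⌈/⌉ {x} {m} (suc r) x<m rewrite ⌈/⌉-suc m r = begin-strict
  x / suc r                          <⟨ n<1+n _ ⟩
  suc (x / suc r)                    ≡⟨ m*n/n≡m (suc (x / suc r)) (suc r) ⟨
  suc (x / suc r) * suc r / suc r    ≤⟨ /-monoˡ-≤ (suc r) (+-monoʳ-≤ (suc r) (m/n*n≤m x (suc r))) ⟩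
  (suc r + x) / suc r                ≡⟨ cong (_/ suc r) (+-comm (suc r) x) ⟩
  (x + suc r) / suc r                ≡⟨ cong (_/ suc r) (+-suc x r) ⟩
  (suc x + r) / suc r                ≤⟨ /-monoˡ-≤ (suc r) (+-monoˡ-≤ r x<m) ⟩
  (m + r) / suc r                    ∎
  where open ≤-Reasoning

∑-/-fibre≤ : ∀ r .{{_ : NonZero r}} q a m → ∑[ x < m ] indicator ((toℕ x + a) / r ℕ.≟ q) ≤ r
∑-/-fibre≤ r q a m = proj₂ (bounds a m)
  where
  fibre : ℕ → ℕ → ℕ
  fibre a m = ∑[ x < m ] indicator ((toℕ x + a) / r ℕ.≟ q)

  -- the fibre of q is the block [q r , q r + r), so at most q r + r ∸ a of its points are ≥ a
  bounds : ∀ a m → fibre a m ≤ (q * r + r) ∸ a × fibre a m ≤ r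
  bounds a zero    = z≤n , z≤n
  bounds a (suc m) with bounds (suc a) m
  ... | below , ≤r rewrite sum-cong-≗ {m} (λ x → cong (λ b → indicator (b / r ℕ.≟ q)) (sym (+-suc (toℕ x) a)))
    with a / r ℕ.≟ q
  ... | no _ = ≤-trans below (∸-monoʳ-≤ (q * r + r) (n≤1+n a)) , ≤r
  ... | yes a/r≡q = bound , ≤-trans bound (begin
      (q * r + r) ∸ a           ≤⟨ ∸-monoʳ-≤ (q * r + r) qr≤a ⟩
      (q * r + r) ∸ q * r       ≡⟨ m+n∸m≡n (q * r) r ⟩
      r                         ∎)
    where
    open ≤-Reasoning
    qr≤a : q * r ≤ a
    qr≤a = subst (λ b → b * r ≤ a) a/r≡q (m/n*n≤m a r)
    a<qr+r : a < q * r + r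
    a<qr+r = begin-strict
      a                         ≡⟨ m≡m%n+[m/n]*n a r ⟩
      a % r + a / r * r         <⟨ +-monoˡ-< (a / r * r) (m%n<n a r) ⟩
      r + a / r * r             ≡⟨ cong (λ b → r + b * r) a/r≡q ⟩
      r + q * r                 ≡⟨ +-comm r (q * r) ⟩
      q * r + r                 ∎
    bound : suc (fibre (suc a) m) ≤ (q * r + r) ∸ a
    bound = begin
      suc (fibre (suc a) m)     ≤⟨ s≤s below ⟩
      suc ((q * r + r) ∸ suc a) ≡⟨ +-∸-assoc 1 a<qr+r ⟨
      (q * r + r) ∸ a           ∎

offset : ∀ {t} → (Fin t → ℕ) → Fin t → ℕ
offset g zero    = 0
offset g (suc i) = g zero + offset (g ∘ suc) i

offset+g≤∑g : ∀ {t} (g : Fin t → ℕ) i → offset g i + g i ≤ sum g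
offset+g≤∑g g zero    = m≤m+n (g zero) _
offset+g≤∑g g (suc i) = begin
  g zero + offset (g ∘ suc) i + g (suc i)   ≡⟨ +-assoc (g zero) _ _ ⟩
  g zero + (offset (g ∘ suc) i + g (suc i)) ≤⟨ +-monoʳ-≤ (g zero) (offset+g≤∑g (g ∘ suc) i) ⟩
  g zero + sum (g ∘ suc)                    ∎
  where open ≤-Reasoning

<head⇒<offset-suc : ∀ {t} (g : Fin (suc t) → ℕ) {j a b} → a < g zero → a < offset g (suc j) + b
<head⇒<offset-suc g {j} {a} {b} a<g₀ = begin-strict
  a                                      <⟨ a<g₀ ⟩
  g zero                                 ≤⟨ m≤m+n (g zero) _ ⟩
  g zero + (offset (g ∘ suc) j + b)      ≡⟨ +-assoc (g zero) _ b ⟨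
  offset g (suc j) + b                   ∎
  where open ≤-Reasoning

offset-injective : ∀ {t} (g : Fin t → ℕ) {i j a b} → a < g i → b < g j →
  offset g i + a ≡ offset g j + b → i ≡ j
offset-injective g {zero}  {zero}  _   _   _  = refl
offset-injective g {zero}  {suc j} a<g _   eq = contradiction eq (<⇒≢ (<head⇒<offset-suc g {j} a<g))
offset-injective g {suc i} {zero}  _   b<g eq = contradiction (sym eq) (<⇒≢ (<head⇒<offset-suc g {i} b<g))
offset-injective g {suc i} {suc j} a<g b<g eq =
  cong suc (offset-injective (g ∘ suc) a<g b<g
    (+-cancelˡ-≡ (g zero) _ _ (trans (sym (+-assoc (g zero) _ _)) (trans eq (+-assoc (g zero) _ _)))))

module _ {t : ℕ} {n : Fin t → ℕ} {k : ℕ} (f : Vertex t n → Fin k) where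

  classSizeIn : Fin t → Fin k → ℕ
  classSizeIn i c = ∑[ x < n i ] indicator (f (i , x) ≟ c)

  classSize≡∑classSizeIn : ∀ c → classSize t n k f c ≡ ∑[ i < t ] classSizeIn i c
  classSize≡∑classSizeIn c = begin
    length (filter (λ v → f v ≟ c) (allVertices t n))      ≡⟨ length-filter≡∑indicator (λ v → f v ≟ c) (allVertices t n) ⟩
    List.sum (map count (concatMap part (allFin t)))       ≡⟨ sum-map-concatMap count part (allFin t) ⟩
    List.sum (map (List.sum ∘ map count ∘ part) (allFin t)) ≡⟨ sum-map-allFin t _ ⟩
    ∑[ i < t ] List.sum (map count (part i))              ≡⟨ sum-cong-≗ countPart ⟩
    ∑[ i < t ] classSizeIn i c                            ∎
    where
    open ≡-Reasoning
    count : Vertex t n → ℕ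
    count v = indicator (f v ≟ c)
    part : Fin t → List (Vertex t n)
    part i = map (i ,_) (allFin (n i))
    countPart : ∀ i → List.sum (map count (part i)) ≡ classSizeIn i c
    countPart i = trans (cong List.sum (sym (map-∘ (allFin (n i))))) (sum-map-allFin (n i) _)

  ∑classSizeIn≡n : ∀ i → ∑[ c < k ] classSizeIn i c ≡ n i
  ∑classSizeIn≡n i = begin
    ∑[ c < k ] ∑[ x < n i ] indicator (f (i , x) ≟ c) ≡⟨ ∑-comm (λ c x → indicator (f (i , x) ≟ c)) ⟩
    ∑[ x < n i ] ∑[ c < k ] indicator (f (i , x) ≟ c) ≡⟨ sum-cong-≗ (λ x → ∑-indicator-≟ (f (i , x))) ⟩
    ∑[ x < n i ] 1                                    ≡⟨ ∑-const (n i) 1 ⟩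
    n i * 1                                           ≡⟨ *-identityʳ (n i) ⟩
    n i                                               ∎
    where open ≡-Reasoning

  classSizeIn≤classSize : ∀ i c → classSizeIn i c ≤ classSize t n k f c
  classSizeIn≤classSize i c =
    ≤-trans (f≤∑f (λ j → classSizeIn j c) i) (≤-reflexive (sym (classSize≡∑classSizeIn c)))

  missing⇒classSize≡0 : ∀ c → (∀ v → f v ≢ c) → classSize t n k f c ≡ 0
  missing⇒classSize≡0 c missing = trans (classSize≡∑classSizeIn c)
    (∑≡0 (λ i → ∑≡0 (λ x → indicator-no (f (i , x) ≟ c) (missing (i , x)))))

  proper⇒classSizeIn-unique : Proper t n k f → ∀ c i j → 0 < classSizeIn i c → 0 < classSizeIn j c → i ≡ j
  proper⇒classSizeIn-unique proper c i j i-meets-c j-meets-c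
    with ∑>0⇒∃>0 _ i-meets-c | ∑>0⇒∃>0 _ j-meets-c | i ≟ j
  ... | _ | _ | yes i≡j = i≡j
  ... | x , fx≡c | y , fy≡c | no i≢j = contradiction
    (trans (indicator>0⇒ (f (i , x) ≟ c) fx≡c) (sym (indicator>0⇒ (f (j , y) ≟ c) fy≡c)))
    (proper (i , x) (j , y) i≢j)

sumCeil≡∑ : ∀ t (n : Fin t → ℕ) r .{{_ : NonZero r}} → sumCeil t n r ≡ ∑[ i < t ] ⌈ n i / r ⌉
sumCeil≡∑ t n r = sum-map-allFin t (λ i → ⌈ n i / r ⌉)

equitableMissing⇒sumCeil<k : ∀ {t n k} r .{{_ : NonZero r}} (f : Vertex t n → Fin k) →
  Proper t n k f → REquitable t n k r f → SomeColorMissing t n k f → sumCeil t n r < k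
equitableMissing⇒sumCeil<k {t} {n} {k} r f proper equitable (c₀ , missing) = begin-strict
  sumCeil t n r                    ≡⟨ sumCeil≡∑ t n r ⟩
  ∑[ i < t ] ⌈ n i / r ⌉           ≤⟨ ∑-mono-≤ ⌈n/r⌉≤colours ⟩
  ∑[ i < t ] ∑[ c < k ] uses i c   ≡⟨ ∑-comm uses ⟩
  ∑[ c < k ] ∑[ i < t ] uses i c   <⟨ ≤1-with-zero⇒∑<m _ c₀ usedOnce c₀-unused ⟩
  k                                ∎
  where
  open ≤-Reasoning
  uses : Fin t → Fin k → ℕ
  uses i c = indicator (0 <? classSizeIn f i c)

  classSizeIn≤r : ∀ i c → classSizeIn f i c ≤ r
  classSizeIn≤r i c = ≤-trans (classSizeIn≤classSize f i c)
    (subst (λ s → classSize t n k f c ≤ s + r) (missing⇒classSize≡0 f c₀ missing) (equitable c c₀))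

  ⌈n/r⌉≤colours : ∀ i → ⌈ n i / r ⌉ ≤ ∑[ c < k ] uses i c
  ⌈n/r⌉≤colours i = ⌈/⌉-least r (begin
    n i                              ≡⟨ ∑classSizeIn≡n f i ⟨
    ∑[ c < k ] classSizeIn f i c     ≤⟨ ∑-mono-≤ (λ c → ≤*indicator>0 (classSizeIn≤r i c)) ⟩
    ∑[ c < k ] (r * uses i c)        ≡⟨ *-distribˡ-sum r (uses i) ⟨
    r * ∑[ c < k ] uses i c          ∎)

  usedOnce : ∀ c → ∑[ i < t ] uses i c ≤ 1
  usedOnce c = ∑≤-singleSupport (λ i → uses i c) (λ i → indicator≤1 _) λ i j i-uses j-uses →
    proper⇒classSizeIn-unique f proper c i j (indicator>0⇒ _ i-uses) (indicator>0⇒ _ j-uses)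

  c₀-unused : ∑[ i < t ] uses i c₀ ≡ 0
  c₀-unused = ∑≡0 λ i → indicator-no _ λ i-meets-c₀ →
    <⇒≱ i-meets-c₀ (≤-trans (classSizeIn≤classSize f i c₀) (≤-reflexive (missing⇒classSize≡0 f c₀ missing)))

module BlockColouring {t : ℕ} {n : Fin t → ℕ} {k : ℕ} (r : ℕ) .{{_ : NonZero r}} (S<k : sumCeil t n r < k) where

  blocks : Fin t → ℕ
  blocks i = ⌈ n i / r ⌉

  block : Vertex t n → ℕ
  block (i , x) = offset blocks i + toℕ x / r

  block<S : ∀ v → block v < sumCeil t n r
  block<S (i , x) = begin-strict
    offset blocks i + toℕ x / r    <⟨ +-monoʳ-< (offset blocks i) (/<⌈/⌉ r (toℕ<n x)) ⟩
    offset blocks i + blocks i     ≤⟨ offset+g≤∑g blocks i ⟩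
    ∑[ i < t ] blocks i            ≡⟨ sumCeil≡∑ t n r ⟨
    sumCeil t n r                  ∎
    where open ≤-Reasoning

  colouring : Vertex t n → Fin k
  colouring v = fromℕ< (<-trans (block<S v) S<k)

  toℕ-colouring : ∀ v → toℕ (colouring v) ≡ block v
  toℕ-colouring v = toℕ-fromℕ< (<-trans (block<S v) S<k)

  proper : Proper t n k colouring
  proper (i , x) (j , y) i≢j same = i≢j (offset-injective blocks (/<⌈/⌉ r (toℕ<n x)) (/<⌈/⌉ r (toℕ<n y))
    (trans (sym (toℕ-colouring (i , x))) (trans (cong toℕ same) (toℕ-colouring (j , y)))))

  missing : SomeColorMissing t n k colouring
  missing = fromℕ< S<k , λ v same →
    <⇒≢ (block<S v) (trans (sym (toℕ-colouring v)) (trans (cong toℕ same) (toℕ-fromℕ< S<k)))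

  classSize≤r : ∀ c → classSize t n k colouring c ≤ r
  classSize≤r c = subst (_≤ r) (sym (classSize≡∑classSizeIn colouring c))
    (∑≤-singleSupport _ classSizeIn≤r (proper⇒classSizeIn-unique colouring proper c))
    where
    classSizeIn≤r : ∀ i → classSizeIn colouring i c ≤ r
    classSizeIn≤r i = ≤-trans (∑-mono-≤ λ x → indicator-mono (colouring (i , x) ≟ c) _ (inBlock x))
      (∑-/-fibre≤ r (toℕ c ∸ offset blocks i) 0 (n i))
      where
      inBlock : ∀ x → colouring (i , x) ≡ c → (toℕ x + 0) / r ≡ toℕ c ∸ offset blocks i
      inBlock x refl = begin
        (toℕ x + 0) / r                                   ≡⟨ cong (_/ r) (+-identityʳ (toℕ x)) ⟩
        toℕ x / r                                         ≡⟨ m+n∸m≡n (offset blocks i) _ ⟨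
        block (i , x) ∸ offset blocks i                   ≡⟨ cong (_∸ offset blocks i) (toℕ-colouring (i , x)) ⟨
        toℕ (colouring (i , x)) ∸ offset blocks i         ∎
        where open ≡-Reasoning

  equitable : REquitable t n k r colouring
  equitable c d = ≤-trans (classSize≤r c) (m≤n+m r _)

lemma8 : (r : ℕ) → .{{_ : NonZero r}} → (k : ℕ) → 1 ≤ k →
    (t : ℕ) → 2 ≤ t → (n : Fin t → ℕ) →
    (∀ i → 1 ≤ n i) → (∀ i j → i ≤ᶠ j → n i ≤ n j) →
    (Σ (Vertex t n → Fin k) (λ f → Proper t n k f × REquitable t n k r f × SomeColorMissing t n k f))
      ⇔ (sumCeil t n r + 1 ≤ k)
lemma8 r k _ t _ n _ _ = mk⇔
  (λ (f , proper , equitable , missing) → <⇒+1≤ (equitableMissing⇒sumCeil<k r f proper equitable missing))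
  (λ S+1≤k → let open BlockColouring {t} {n} {k} r (+1≤⇒< S+1≤k) in colouring , proper , equitable , missing)
  where
  <⇒+1≤ : ∀ {m n} → m < n → m + 1 ≤ n
  <⇒+1≤ {m} {n} = subst (_≤ n) (+-comm 1 m)
  +1≤⇒< : ∀ {m n} → m + 1 ≤ n → m < n
  +1≤⇒< {m} {n} = subst (_≤ n) (+-comm m 1)
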